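{- Let $G\in\mathrm{BP2}\setminus\mathrm{BP1}$ be a graph that admits no star-biclique partition. Then for every vertex $v$ of $G$, the graph $G-v$ also belongs to $\mathrm{BP2}\setminus\mathrm{BP1}$.
   Context: All graphs are finite, simple and undirected. A biclique of a graph $G$ is a subgraph of $G$ isomorphic to $K_1$ or to $K_{m,n}$ for some $m,n\ge1$; a star is a biclique isomorphic to $K_1$ or to $K_{1,n}$ for some $n\ge1$. BP$k$ is the set of graphs whose vertex set can be covered by at most $k$ bicliques (equivalently partitioned into at most $k$ parts, each the vertex set of a biclique). A star-biclique partition of $G$ is a partition of $V(G)$ into two sets $S,T$ such that $G[S]$ has a spanning star and $G[T]$ has a spanning biclique. $G-v$ is the induced subgraph on $V(G)\setminus\{v\}$. -}

module Defs where

open import Data.Nat using (ℕ; suc)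
open import Data.Fin using (Fin; punchIn)
open import Data.Bool using (Bool; true; false)
open import Data.Product using (Σ; ∃; _×_; _,_)
open import Data.Sum using (_⊎_)
open import Relation.Binary.PropositionalEquality using (_≡_)
open import Relation.Nullary using (¬_)

record Graph (n : ℕ) : Set₁ where
  field
    Adj   : Fin n → Fin n → Set
    sym   : ∀ {x y} → Adj x y → Adj y x
    irrefl : ∀ {x} → ¬ Adj x x
open Graph public

_-v_ : ∀ {n} → Graph (suc n) → Fin (suc n) → Graph n
G -v v = record
  { Adj = λ x y → Adj G (punchIn v x) (punchIn v y)
  ; sym = sym G
  ; irrefl = irrefl G }

IsSingleton : ∀ {n} → (Fin n → Set) → Set
IsSingleton P = ∃ λ x → P x × (∀ y → P y → y ≡ x)

-- G[P] has a spanning biclique: either P is a single vertex (K_1), or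
-- P splits into two nonempty sides with every cross pair adjacent (K_{m,n}).
SpansBiclique : ∀ {n} → Graph n → (Fin n → Set) → Set
SpansBiclique G P =
  IsSingleton P ⊎
  Σ (_ → Bool) λ side →
    (∃ λ a → P a × side a ≡ true) ×
    (∃ λ b → P b × side b ≡ false) ×
    (∀ a b → P a → P b → side a ≡ true → side b ≡ false → Adj G a b)

-- G[P] has a spanning star: K_1, or K_{1,m} (one side a single vertex).
SpansStar : ∀ {n} → Graph n → (Fin n → Set) → Set
SpansStar G P =
  IsSingleton P ⊎
  Σ (_ → Bool) λ side →
    (∃ λ a → P a × side a ≡ true) ×
    (∀ a a' → P a → P a' → side a ≡ true → side a' ≡ true → a ≡ a') ×
    (∃ λ b → P b × side b ≡ false) ×
    (∀ a b → P a → P b → side a ≡ true → side b ≡ false → Adj G a b)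

-- BP k: V(G) partitioned into at most k parts, each the vertex set of a
-- biclique. Parts are the nonempty colour classes of c : Fin n → Fin k.
BP : ∀ {n} → ℕ → Graph n → Set
BP {n} k G = Σ (Fin n → Fin k) λ c →
  ∀ i → (∃ λ x → c x ≡ i) → SpansBiclique G (λ x → c x ≡ i)

StarBicliquePartition : ∀ {n} → Graph n → Set
StarBicliquePartition {n} G = Σ (Fin n → Bool) λ inS →
  SpansStar G (λ x → inS x ≡ true) × SpansBiclique G (λ x → inS x ≡ false)

module Submission where

-- Let c be a 2-colouring of G whose colour classes span bicliques, and v a vertex.
--
-- * G - v ∈ BP2: restrict c to G - v.  A class biclique that keeps vertices on
--   both of its sides after deleting v is still a biclique of G - v.  Otherwise
--   one side consisted of v alone, so that class spans a star in G; together
--   with the other class this gives a star-biclique partition of G, or, if the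
--   other class is empty, shows G ∈ BP1.  Both are excluded.
-- * G - v ∉ BP1: if G - v has no vertices then G = K₁ ∈ BP1; otherwise a
--   spanning biclique of G - v, lifted to G, covers V(G) ∖ {v}, and together
--   with the star {v} forms a star-biclique partition of G.

open import Defs hiding (sym)
open import Data.Nat using (ℕ; suc; zero)
open import Data.Fin using (Fin; zero; suc; punchIn; punchOut; _≟_)
open import Data.Fin.Properties
  using (punchIn-injective; punchInᵢ≢i; punchIn-punchOut; punchOut-punchIn; punchOut-cong; any?)
open import Data.Bool using (Bool; true; false; not)
import Data.Bool as Bool
open import Data.Bool.Properties using (not-injective)
open import Data.Product using (∃; _×_; _,_)
open import Data.Sum using (_⊎_; inj₁; inj₂; [_,_])
open import Data.Empty using (⊥-elim)
open import Function using (_∘_)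
open import Relation.Nullary using (¬_; Dec; yes; no; does; ¬?)
open import Relation.Nullary.Decidable using (_×-dec_; dec-true; dec-false; decidable-stable)
open import Level using (0ℓ)
open import Relation.Unary using (Pred; Decidable; _≐_; ∁)
open import Relation.Binary.PropositionalEquality using (_≡_; _≢_; refl; sym; trans; cong)

private
  variable
    n : ℕ

VertexSet : ℕ → Set₁
VertexSet n = Pred (Fin n) 0ℓ

BicliqueSides : Graph n → VertexSet n → (Fin n → Bool) → Set
BicliqueSides G P side =
  (∃ λ a → P a × side a ≡ true) ×
  (∃ λ b → P b × side b ≡ false) ×
  (∀ a b → P a → P b → side a ≡ true → side b ≡ false → Adj G a b)

star-resp : (G : Graph n) {P Q : VertexSet n} → P ≐ Q → SpansStar G P → SpansStar G Q
star-resp G (P⊆Q , Q⊆P) (inj₁ (s , Ps , only-s)) = inj₁ (s , P⊆Q Ps , λ y → only-s y ∘ Q⊆P)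
star-resp G (P⊆Q , Q⊆P) (inj₂ (side , (a , Pa , sa) , centre , (b , Pb , sb) , adj)) =
  inj₂ (side , (a , P⊆Q Pa , sa) , (λ x y Qx Qy → centre x y (Q⊆P Qx) (Q⊆P Qy)) ,
        (b , P⊆Q Pb , sb) , λ x y Qx Qy → adj x y (Q⊆P Qx) (Q⊆P Qy))

biclique-resp : (G : Graph n) {P Q : VertexSet n} → P ≐ Q → SpansBiclique G P → SpansBiclique G Q
biclique-resp G (P⊆Q , Q⊆P) (inj₁ (s , Ps , only-s)) = inj₁ (s , P⊆Q Ps , λ y → only-s y ∘ Q⊆P)
biclique-resp G (P⊆Q , Q⊆P) (inj₂ (side , (a , Pa , sa) , (b , Pb , sb) , adj)) =
  inj₂ (side , (a , P⊆Q Pa , sa) , (b , P⊆Q Pb , sb) , λ x y Qx Qy → adj x y (Q⊆P Qx) (Q⊆P Qy))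

star⇒biclique : (G : Graph n) {P : VertexSet n} → SpansStar G P → SpansBiclique G P
star⇒biclique G (inj₁ single) = inj₁ single
star⇒biclique G (inj₂ (side , a , _ , b , adj)) = inj₂ (side , a , b , adj)

sides⇒star : (G : Graph n) {P : VertexSet n} {side : Fin n → Bool} → BicliqueSides G P side →
  (∀ a a' → P a → P a' → side a ≡ true → side a' ≡ true → a ≡ a') → SpansStar G P
sides⇒star G {side = side} (a , b , adj) centre = inj₂ (side , a , centre , b , adj)

swap-sides : (G : Graph n) {P : VertexSet n} {side : Fin n → Bool} →
  BicliqueSides G P side → BicliqueSides G P (not ∘ side)
swap-sides G ((a , Pa , sa) , (b , Pb , sb) , adj) =
  (b , Pb , cong not sb) , (a , Pa , cong not sa) ,
  λ x y Px Py sx sy → Graph.sym G (adj y x Py Px (not-injective sy) (not-injective sx))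

deleted-or-kept : (v x : Fin (suc n)) → x ≡ v ⊎ ∃ λ y → punchIn v y ≡ x
deleted-or-kept v x with x ≟ v
... | yes x≡v = inj₁ x≡v
... | no x≢v = inj₂ (punchOut (x≢v ∘ sym) , punchIn-punchOut _)

meets-or-⊆v : {Q : VertexSet (suc n)} → Decidable Q → (v : Fin (suc n)) →
  (∃ λ y → Q (punchIn v y)) ⊎ (∀ a → Q a → a ≡ v)
meets-or-⊆v {Q = Q} Q? v with any? (Q? ∘ punchIn v)
... | yes meets = inj₁ meets
... | no misses = inj₂ only-v
  where
    only-v : ∀ a → Q a → a ≡ v
    only-v a Qa with deleted-or-kept v a
    ... | inj₁ a≡v = a≡v
    ... | inj₂ (y , refl) = ⊥-elim (misses (y , Qa))

-- Deleting v from a spanning biclique of G[P] (with P ⊄ {v}) leaves a spanning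
-- biclique of (G - v)[P], unless one side of it was {v}, i.e. G[P] spans a star.
biclique-delete : (G : Graph (suc n)) {P : VertexSet (suc n)} → Decidable P → (v : Fin (suc n)) →
  (∃ λ x → P (punchIn v x)) → SpansBiclique G P →
  SpansBiclique (G -v v) (P ∘ punchIn v) ⊎ SpansStar G P
biclique-delete G P? v (x , Px) (inj₁ (s , _ , only-s)) =
  inj₁ (inj₁ (x , Px , λ y Py → punchIn-injective v y x (trans (only-s _ Py) (sym (only-s _ Px)))))
biclique-delete G P? v _ (inj₂ (side , sides@(_ , _ , adj)))
  with meets-or-⊆v (λ a → P? a ×-dec (side a Bool.≟ true)) v
     | meets-or-⊆v (λ a → P? a ×-dec (side a Bool.≟ false)) v
... | inj₁ (a , Pa , sa) | inj₁ (b , Pb , sb) =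
  inj₁ (inj₂ (side ∘ punchIn v , (a , Pa , sa) , (b , Pb , sb) ,
              λ x y → adj (punchIn v x) (punchIn v y)))
... | inj₂ true-side⊆v | _ =
  inj₂ (sides⇒star G sides λ a a' Pa Pa' sa sa' →
          trans (true-side⊆v a (Pa , sa)) (sym (true-side⊆v a' (Pa' , sa'))))
... | inj₁ _ | inj₂ false-side⊆v =
  inj₂ (sides⇒star G (swap-sides G sides) λ a a' Pa Pa' sa sa' →
          trans (false-side⊆v a (Pa , not-injective sa))
                (sym (false-side⊆v a' (Pa' , not-injective sa'))))

-- A side function on G - v, extended to G (the value at v is irrelevant).
extend-side : (v : Fin (suc n)) → (Fin n → Bool) → Fin (suc n) → Bool
extend-side v side x with x ≟ v
... | yes _ = true
... | no x≢v = side (punchOut (x≢v ∘ sym))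

extend-side-punchIn : (v : Fin (suc n)) (side : Fin n → Bool) (y : Fin n) →
  extend-side v side (punchIn v y) ≡ side y
extend-side-punchIn v side y with punchIn v y ≟ v
... | yes y≡v = ⊥-elim (punchInᵢ≢i v y y≡v)
... | no _ = cong side (trans (punchOut-cong v refl) (punchOut-punchIn v))

Image : (v : Fin (suc n)) → VertexSet n → VertexSet (suc n)
Image v P x = ∃ λ y → punchIn v y ≡ x × P y

biclique-lift : (G : Graph (suc n)) {P : VertexSet n} (v : Fin (suc n)) →
  SpansBiclique (G -v v) P → SpansBiclique G (Image v P)
biclique-lift G v (inj₁ (s , Ps , only-s)) =
  inj₁ (punchIn v s , (s , refl , Ps) , λ { _ (y , refl , Py) → cong (punchIn v) (only-s y Py) })
biclique-lift G {P = P} v (inj₂ (side , (a , Pa , sa) , (b , Pb , sb) , adj)) =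
  inj₂ (extend-side v side ,
        (punchIn v a , (a , refl , Pa) , trans (extend-side-punchIn v side a) sa) ,
        (punchIn v b , (b , refl , Pb) , trans (extend-side-punchIn v side b) sb) ,
        lifted-adj)
  where
    lifted-adj : ∀ x y → Image v P x → Image v P y →
      extend-side v side x ≡ true → extend-side v side y ≡ false → Adj G x y
    lifted-adj _ _ (x , refl , Px) (y , refl , Py) sx sy =
      adj x y Px Py (trans (sym (extend-side-punchIn v side x)) sx)
                    (trans (sym (extend-side-punchIn v side y)) sy)

partition-from : (G : Graph n) {S : VertexSet n} → Decidable S →
  SpansStar G S → SpansBiclique G (∁ S) → StarBicliquePartition G
partition-from G {S = S} S? star biclique =
  (does ∘ S?) ,
  star-resp G ((λ {x} → dec-true (S? x)) , λ {x} → in-S (S? x)) star ,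
  biclique-resp G ((λ {x} → dec-false (S? x)) , λ {x} → out-S (S? x)) biclique
  where
    in-S : ∀ {x} (d : Dec (S x)) → does d ≡ true → S x
    in-S (yes Sx) _ = Sx
    in-S (no _) ()
    out-S : ∀ {x} (d : Dec (S x)) → does d ≡ false → ¬ S x
    out-S (yes _) ()
    out-S (no ¬Sx) _ = ¬Sx

spanning⇒BP1 : (G : Graph n) {P : VertexSet n} → SpansBiclique G P → (∀ x → P x) → BP 1 G
spanning⇒BP1 G b all = (λ _ → zero) , λ { zero _ → biclique-resp G ((λ _ → refl) , λ {x} _ → all x) b }

other-colour : {i j k : Fin 2} → j ≢ i → k ≢ i → j ≡ k
other-colour {zero}     {zero}     {_}        j≢i _   = ⊥-elim (j≢i refl)
other-colour {zero}     {suc zero} {zero}     _   k≢i = ⊥-elim (k≢i refl)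
other-colour {zero}     {suc zero} {suc zero} _   _   = refl
other-colour {suc zero} {suc zero} {_}        j≢i _   = ⊥-elim (j≢i refl)
other-colour {suc zero} {zero}     {suc zero} _   k≢i = ⊥-elim (k≢i refl)
other-colour {suc zero} {zero}     {zero}     _   _   = refl

star-class : (G : Graph n) (c : Fin n → Fin 2) →
  (∀ i → (∃ λ x → c x ≡ i) → SpansBiclique G (λ x → c x ≡ i)) →
  ∀ i → SpansStar G (λ x → c x ≡ i) → StarBicliquePartition G ⊎ BP 1 G
star-class G c classes i star with any? (λ x → ¬? (c x ≟ i))
... | yes (x , cx≢i) =
  inj₁ (partition-from G (λ y → c y ≟ i) star
         (biclique-resp G ((λ cy≡cx cy≡i → cx≢i (trans (sym cy≡cx) cy≡i)) ,
                         λ cy≢i → other-colour cy≢i cx≢i)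
                        (classes (c x) (x , refl))))
... | no all-i =
  inj₂ (spanning⇒BP1 G (star⇒biclique G star) λ x →
          decidable-stable (c x ≟ i) (λ cx≢i → all-i (x , cx≢i)))

deletion-BP2 : (G : Graph (suc n)) → BP 2 G → ¬ BP 1 G → ¬ StarBicliquePartition G →
  (v : Fin (suc n)) → BP 2 (G -v v)
deletion-BP2 G (c , classes) ¬bp1 ¬sbp v = c ∘ punchIn v , restricted-class
  where
    restricted-class : ∀ i → (∃ λ x → c (punchIn v x) ≡ i) →
      SpansBiclique (G -v v) (λ x → c (punchIn v x) ≡ i)
    restricted-class i (x , cx≡i)
      with biclique-delete G (λ y → c y ≟ i) v (x , cx≡i) (classes i (punchIn v x , cx≡i))
    ... | inj₁ biclique = biclique
    ... | inj₂ star = ⊥-elim ([ ¬sbp , ¬bp1 ] (star-class G c classes i star))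

deletion-BP1 : (G : Graph (suc n)) (v : Fin (suc n)) → BP 1 (G -v v) →
  StarBicliquePartition G ⊎ BP 1 G
deletion-BP1 {zero} G v _ = inj₂ ((λ _ → zero) , λ { zero _ → inj₁ (zero , refl , λ { zero _ → refl }) })
deletion-BP1 {suc n} G v (c , classes) =
  inj₁ (partition-from G (_≟ v) (inj₁ (v , refl , λ _ x≡v → x≡v))
         (biclique-resp G ((λ { (y , refl , _) → punchInᵢ≢i v y }) ,
                         λ x≢v → punchOut (x≢v ∘ sym) , punchIn-punchOut _ , single-colour _)
                        (biclique-lift G v (classes zero (zero , single-colour _)))))
  where
    single-colour : (k : Fin 1) → k ≡ zero
    single-colour zero = refl

lemma5 : ∀ {n} (G : Graph (suc n)) → BP 2 G → ¬ BP 1 G → ¬ StarBicliquePartition G →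
           ∀ (v : Fin (suc n)) → BP 2 (G -v v) × ¬ BP 1 (G -v v)
lemma5 G bp2 ¬bp1 ¬sbp v =
  deletion-BP2 G bp2 ¬bp1 ¬sbp v ,
  λ bp1-of-deletion → [ ¬sbp , ¬bp1 ] (deletion-BP1 G v bp1-of-deletion)
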